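{- Let $\mathbf{a}=(a_0,\ldots,a_{m-1})$ be a weak $m$-part composition of $n$ and let $t=(k,l)$ be a lattice point with $0\le k\le n$ and $0\le l\le m$. Suppose that the point $(k+1,l)$ is dominated by every cyclic shift $\mathbf{a}^{j}$, $0\le j<m$ (i.e. $k+1\ge f_{\mathbf{a}^j}(l)$ for all $j$). Then $$|\mathscr{A}_t(\mathbf{a})| = m\binom{k+l}{l},\qquad |\mathscr{B}_t(\mathbf{a})| = n\binom{k+l}{l-1},$$ and $$|\mathscr{G}_t(\mathbf{a})| = |\mathscr{A}_t(\mathbf{a})|-|\mathscr{B}_t(\mathbf{a})| = \frac{m(k+1)-nl}{k+1}\binom{k+l}{l}.$$
   Context: A lattice path is a path in $\mathbb{Z}\times\mathbb{Z}$ using unit steps $(0,1)$ (up) and $(1,0)$ (right). A weak $m$-part composition of $n$ is a tuple $\mathbf{a}=(a_0,\ldots,a_{m-1})$ of nonnegative integers with sum $n$; indices of $\mathbf{a}$ are read modulo $m$. Define $f_{\mathbf{a}}:[0,m]\to\mathbb{R}$ by $f_{\mathbf{a}}(y)=a_i(y-i)+\sum_{j=0}^{i-1}a_j$ for $y\in[i,i+1]$, $i=0,\ldots,m-1$; its graph $\{x=f_{\mathbf{a}}(y)\}$ is the boundary curve of $\mathbf{a}$. A lattice point $(x,y)$ with $0\le y\le m$ is dominated by $\mathbf{a}$ if $x\ge f_{\mathbf{a}}(y)$, and a lattice path is dominated by $\mathbf{a}$ if all its lattice points are. For an integer $j$ the $j$-th cyclic shift is $\mathbf{a}^{j}=(a_{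 -j},a_{ -j+1},\ldots,a_{ -j+m-1})$ (indices mod $m$). A lattice path boundary pair (LPBP) is an ordered pair $(P,(\mathbf{a},j))$ where $P$ is a lattice path starting at the origin and $0\le j<m$; it is good if $P$ is dominated by $\mathbf{a}^j$ and bad otherwise. $\mathscr{A}_t(\mathbf{a})$ is the set of all LPBPs $(P,(\mathbf{a},j))$ with $P$ ending at $t$, and $\mathscr{B}_t(\mathbf{a})$, $\mathscr{G}_t(\mathbf{a})$ are its subsets of bad and good pairs respectively. -}

module Defs where

open import Data.Nat using (ℕ; zero; suc; _+_; _*_; _∸_; _≤ᵇ_)
open import Data.Nat.DivMod using (_mod_)
open import Data.Nat.Combinatorics using (_C_)
open import Data.Fin using (Fin; toℕ)
import Data.Fin as Fin
open import Data.List.Base using (List; []; _∷_; all; map; allFin)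
open import Data.Nat.ListAction using (sum)
open import Data.Product using (Σ; _×_; _,_; proj₁)
open import Data.Bool using (Bool; true; false)
open import Relation.Binary.PropositionalEquality using (_≡_)

-- A weak m-part composition is a function a : Fin m → ℕ; its sum:
total : ∀ {m} → (Fin m → ℕ) → ℕ
total {m} a = sum (map a (allFin m))

-- Boundary curve at an integer height y: f_a(y) = a_0 + ... + a_{y-1}
-- (for 0 ≤ y ≤ m this is exactly the paper's f_a evaluated at y).
bdry : ∀ {m} → (Fin m → ℕ) → ℕ → ℕ
bdry {zero}  a y       = 0
bdry {suc m} a zero    = 0
bdry {suc m} a (suc y) = a Fin.zero + bdry (λ i → a (Fin.suc i)) y

cshift : ∀ {m} → Fin m → (Fin m → ℕ) → (Fin m → ℕ)
cshift {suc m} j a i = a ((toℕ i + suc m ∸ toℕ j) mod suc m)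

-- Lattice paths: lists of unit steps, starting at the origin.
data Step : Set where
  up right : Step

pointsFrom : ℕ × ℕ → List Step → List (ℕ × ℕ)
pointsFrom p [] = p ∷ []
pointsFrom (x , y) (up ∷ s) = (x , y) ∷ pointsFrom (x , suc y) s
pointsFrom (x , y) (right ∷ s) = (x , y) ∷ pointsFrom (suc x , y) s

endFrom : ℕ × ℕ → List Step → ℕ × ℕ
endFrom p [] = p
endFrom (x , y) (up ∷ s) = endFrom (x , suc y) s
endFrom (x , y) (right ∷ s) = endFrom (suc x , y) s

PathTo : ℕ → ℕ → Set
PathTo k l = Σ (List Step) (λ P → endFrom (0 , 0) P ≡ (k , l))

dominated : ∀ {m} → (Fin m → ℕ) → List Step → Bool
dominated b P = all (λ { (x , y) → bdry b y ≤ᵇ x }) (pointsFrom (0 , 0) P)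

-- 𝒜_t(a), t = (k , l): pairs (P , (a , j))
𝒜 : ∀ {m} → (Fin m → ℕ) → ℕ → ℕ → Set
𝒜 {m} a k l = PathTo k l × Fin m

𝒢 : ∀ {m} → (Fin m → ℕ) → ℕ → ℕ → Set
𝒢 a k l = Σ (𝒜 a k l) (λ { (P , j) → dominated (cshift j a) (proj₁ P) ≡ true })

ℬ : ∀ {m} → (Fin m → ℕ) → ℕ → ℕ → Set
ℬ a k l = Σ (𝒜 a k l) (λ { (P , j) → dominated (cshift j a) (proj₁ P) ≡ false })

choosePred : ℕ → ℕ → ℕ
choosePred N zero = 0
choosePred N (suc l) = N C l

module Submission where

-- For the bad pairs we use a potential argument.  Read a
-- cyclically from position r; its boundary bd r has first column x = α r = a_r.  For a path P let
-- c_r(y) be the number of up-steps P takes before its bd r y-th right-step; P is dominated by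
-- that boundary iff c_r(y) < y for 1 ≤ y ≤ l, and the potential of P is max(0, c_r(y) − y).
-- Rotating P, i.e. moving its first α r right-steps (with the up-steps before them) to its end,
-- turns c_r into c_{r+1} shifted by one, and a pointwise computation gives
--     potential_r(P) + 1 = climb_r(P) + potential_{r+1}(rotated P) + [P dominated by bd r],
-- where climb_r(P) = c_r(1).  Rotation permutes the paths to t, so summing over all paths and
-- over one period r = 0, …, m − 1 the potentials telescope:  m·#paths = Σ climbs + #good pairs.
-- The climbs add up to n·U(1), where U(d) is the total number of up-steps before the d-th
-- right-step; rotation invariance makes U additive, so (k + 1)·U(1) = U(k + 1) = l·#paths, i.e.
-- U(1) = C(k+l, l−1).  This gives |ℬ| = n·C(k+l, l−1) and |𝒢| = |𝒜| − |ℬ|.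

open import Defs
open import Axiom.UniquenessOfIdentityProofs.WithK using (uip)
open import Data.Bool using (Bool; true; false; _∧_)
open import Data.Bool.ListAction using (all)
open import Data.Bool.Properties using (T-≡)
open import Data.Fin using (Fin; toℕ; fromℕ<)
import Data.Fin as Fin
open import Data.Fin.Permutation using (Permutation; _⟨$⟩ʳ_)
open import Data.Fin.Properties using (toℕ-injective; toℕ-fromℕ<; toℕ<n; +↔⊎; *↔×)
open import Data.List.Base using (List; []; _∷_; _++_; [_]; _∷ʳ_; replicate; reverse; map; allFin; tabulate)
open import Data.List.Properties using (++-assoc; ++-identityʳ; reverse-++; reverse-involutive; unfold-reverse; map-tabulate)
open import Data.Nat using (ℕ; zero; suc; _+_; _*_; _∸_; _⊔_; _≤_; _<_; z≤n; s≤s; _≤ᵇ_; _≤?_)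
open import Data.Nat.Combinatorics using (_C_; nCn≡1; nCk+nC[k+1]≡[n+1]C[k+1])
open import Data.Nat.DivMod using (_mod_; _%_; [m+n]%n≡m%n; m<n⇒m%n≡m)
open import Data.Nat.ListAction using (sum)
open import Data.Nat.Properties
open import Algebra.Properties.CommutativeMonoid.Sum +-0-commutativeMonoid
  using (sum-syntax; sum-cong-≗; ∑-permute; ∑-distrib-+)
open import Algebra.Properties.CommutativeSemigroup +-commutativeSemigroup using (interchange)
open import Data.Nat.Tactic.RingSolver using (solve-∀)
open import Data.Product using (Σ; _×_; _,_; proj₁; proj₂)
open import Data.Product.Function.Dependent.Propositional using (Σ-↔)
open import Data.Product.Function.NonDependent.Propositional using (_×-↔_)
open import Data.Sum using (_⊎_; inj₁; inj₂)
open import Data.Sum.Function.Propositional using (_⊎-↔_)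
open import Function.Base using (_∘_; case_of_)
open import Function.Bundles using (_↔_; mk↔ₛ′; Inverse; Equivalence)
open import Function.Properties.Inverse using (↔-refl; ↔-sym; ↔-trans)
open import Function.Related.Propositional using (module EquationalReasoning)
open import Function.Related.TypeIsomorphisms using (Σ-assoc; ×-comm)
open import Relation.Binary.PropositionalEquality hiding ([_])
open import Relation.Nullary using (yes; no)

#up #right : List Step → ℕ
#up []          = 0
#up (up ∷ P)    = suc (#up P)
#up (right ∷ P) = #up P
#right []          = 0
#right (up ∷ P)    = #right P
#right (right ∷ P) = suc (#right P)

endFrom-counts : ∀ x y P → endFrom (x , y) P ≡ (x + #right P , y + #up P)
endFrom-counts x y []          = cong₂ _,_ (sym (+-identityʳ x)) (sym (+-identityʳ y))
endFrom-counts x y (up ∷ P)    = trans (endFrom-counts x (suc y) P) (cong (x + #right P ,_) (sym (+-suc y (#up P))))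
endFrom-counts x y (right ∷ P) = trans (endFrom-counts (suc x) y P) (cong (_, y + #up P) (sym (+-suc x (#right P))))

end⇒counts : ∀ {P k l} → endFrom (0 , 0) P ≡ (k , l) → #right P ≡ k × #up P ≡ l
end⇒counts {P} e = cong proj₁ e′ , cong proj₂ e′
  where
  e′ : (#right P , #up P) ≡ (_ , _)
  e′ = trans (sym (endFrom-counts 0 0 P)) e

counts⇒end : ∀ {P k l} → #right P ≡ k → #up P ≡ l → endFrom (0 , 0) P ≡ (k , l)
counts⇒end {P} refl refl = endFrom-counts 0 0 P

module _ {k l : ℕ} where

  path : (P : List Step) → #right P ≡ k → #up P ≡ l → PathTo k l
  path P r u = P , counts⇒end {P} r u

  #right-path : (P : PathTo k l) → #right (proj₁ P) ≡ k
  #right-path (P , e) = proj₁ (end⇒counts {P} e)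

  #up-path : (P : PathTo k l) → #up (proj₁ P) ≡ l
  #up-path (P , e) = proj₂ (end⇒counts {P} e)

  path-≡ : {P Q : PathTo k l} → proj₁ P ≡ proj₁ Q → P ≡ Q
  path-≡ {P , p} {.P , q} refl = cong (P ,_) (uip p q)

ups rights : ℕ → List Step
ups n   = replicate n up
rights n = replicate n right

#up-ups : ∀ n → #up (ups n) ≡ n
#up-ups zero    = refl
#up-ups (suc n) = cong suc (#up-ups n)

#right-ups : ∀ n → #right (ups n) ≡ 0
#right-ups zero    = refl
#right-ups (suc n) = #right-ups n

#up-rights : ∀ n → #up (rights n) ≡ 0
#up-rights zero    = refl
#up-rights (suc n) = #up-rights n

#right-rights : ∀ n → #right (rights n) ≡ n
#right-rights zero    = refl
#right-rights (suc n) = cong suc (#right-rights n)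

no-right⇒ups : ∀ P → #right P ≡ 0 → P ≡ ups (#up P)
no-right⇒ups []       _ = refl
no-right⇒ups (up ∷ P) e = cong (up ∷_) (no-right⇒ups P e)

no-up⇒rights : ∀ P → #up P ≡ 0 → P ≡ rights (#right P)
no-up⇒rights []          _ = refl
no-up⇒rights (right ∷ P) e = cong (right ∷_) (no-up⇒rights P e)

#paths : ℕ → ℕ → ℕ
#paths zero    l       = 1
#paths (suc k) zero    = 1
#paths (suc k) (suc l) = #paths (suc k) l + #paths k (suc l)

#paths≡C : ∀ k l → #paths k l ≡ (k + l) C l
#paths≡C zero    l       = sym (nCn≡1 l)
#paths≡C (suc k) zero    = refl
#paths≡C (suc k) (suc l) = begin
  #paths (suc k) l + #paths k (suc l)   ≡⟨ cong₂ _+_ (#paths≡C (suc k) l) (#paths≡C k (suc l)) ⟩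
  (suc k + l) C l + (k + suc l) C suc l ≡⟨ cong (λ z → (suc k + l) C l + z C suc l) (+-suc k l) ⟩
  suc (k + l) C l + suc (k + l) C suc l ≡⟨ nCk+nC[k+1]≡[n+1]C[k+1] (suc (k + l)) l ⟩
  suc (suc (k + l)) C suc l             ≡⟨ cong (λ z → suc z C suc l) (+-suc k l) ⟨
  (suc k + suc l) C suc l               ∎
  where open ≡-Reasoning

#paths-1 : ∀ j → #paths 1 j ≡ suc j
#paths-1 zero    = refl
#paths-1 (suc j) = trans (cong (_+ 1) (#paths-1 j)) (+-comm (suc j) 1)

#paths-to-1 : ∀ k → #paths k 1 ≡ suc k
#paths-to-1 zero    = refl
#paths-to-1 (suc k) = cong suc (#paths-to-1 k)

absorption : ∀ k j → suc j * #paths k (suc j) ≡ suc k * #paths (suc k) j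
absorption zero    j       = trans (*-identityʳ (suc j)) (sym (trans (+-identityʳ (#paths 1 j)) (#paths-1 j)))
absorption (suc k) zero    = trans (+-identityʳ (#paths (suc k) 1)) (trans (#paths-to-1 (suc k)) (sym (*-identityʳ (suc (suc k)))))
absorption (suc k) (suc j) = begin
  suc (suc j) * (#paths (suc k) (suc j) + #paths k (suc (suc j)))
    ≡⟨ distribute j (#paths (suc k) (suc j)) (#paths k (suc (suc j))) ⟩
  suc j * #paths (suc k) (suc j) + (#paths (suc k) (suc j) + suc (suc j) * #paths k (suc (suc j)))
    ≡⟨ cong₂ (λ x y → x + (#paths (suc k) (suc j) + y)) (absorption (suc k) j) (absorption k (suc j)) ⟩
  suc (suc k) * #paths (suc (suc k)) j + (#paths (suc k) (suc j) + suc k * #paths (suc k) (suc j))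
    ≡⟨ collect k (#paths (suc (suc k)) j) (#paths (suc k) (suc j)) ⟩
  suc (suc k) * (#paths (suc (suc k)) j + #paths (suc k) (suc j)) ∎
  where
  open ≡-Reasoning
  distribute : ∀ j b c → suc (suc j) * (b + c) ≡ suc j * b + (b + suc (suc j) * c)
  distribute = solve-∀
  collect : ∀ k a b → suc (suc k) * a + (b + suc k * b) ≡ suc (suc k) * (a + b)
  collect = solve-∀

choosePred-unique : ∀ k l x → suc k * x ≡ #paths k l * l → x ≡ choosePred (k + l) l
choosePred-unique k zero    x e = *-cancelˡ-≡ x 0 (suc k) (trans e (trans (*-zeroʳ (#paths k 0)) (sym (*-zeroʳ (suc k)))))
choosePred-unique k (suc j) x e = *-cancelˡ-≡ x _ (suc k) (begin
  suc k * x                        ≡⟨ e ⟩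
  #paths k (suc j) * suc j         ≡⟨ *-comm (#paths k (suc j)) (suc j) ⟩
  suc j * #paths k (suc j)         ≡⟨ absorption k j ⟩
  suc k * #paths (suc k) j         ≡⟨ cong (suc k *_) (#paths≡C (suc k) j) ⟩
  suc k * ((suc k + j) C j)        ≡⟨ cong (λ z → suc k * (z C j)) (+-suc k j) ⟨
  suc k * ((k + suc j) C j)        ∎)
  where open ≡-Reasoning

singleton-↔ : {A : Set} (c : A) → (∀ x → x ≡ c) → A ↔ Fin 1
singleton-↔ c unique = mk↔ₛ′ (λ _ → Fin.zero) (λ _ → c) (λ { Fin.zero → refl ; (Fin.suc ()) }) (λ x → sym (unique x))

first-step-↔ : ∀ k l → PathTo (suc k) (suc l) ↔ (PathTo (suc k) l ⊎ PathTo k (suc l))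
first-step-↔ k l = mk↔ₛ′ split join split∘join join∘split
  where
  split : PathTo (suc k) (suc l) → PathTo (suc k) l ⊎ PathTo k (suc l)
  split ([] , ())
  split (up ∷ P , e)    = let (r , u) = end⇒counts {up ∷ P} e in inj₁ (path P r (suc-injective u))
  split (right ∷ P , e) = let (r , u) = end⇒counts {right ∷ P} e in inj₂ (path P (suc-injective r) u)
  join : PathTo (suc k) l ⊎ PathTo k (suc l) → PathTo (suc k) (suc l)
  join (inj₁ P) = path (up ∷ proj₁ P) (#right-path P) (cong suc (#up-path P))
  join (inj₂ P) = path (right ∷ proj₁ P) (cong suc (#right-path P)) (#up-path P)
  split∘join : ∀ s → split (join s) ≡ s
  split∘join (inj₁ P) = cong inj₁ (path-≡ refl)
  split∘join (inj₂ P) = cong inj₂ (path-≡ refl)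
  join∘split : ∀ P → join (split P) ≡ P
  join∘split ([] , ())
  join∘split (up ∷ P , e)    = path-≡ refl
  join∘split (right ∷ P , e) = path-≡ refl

paths-↔ : ∀ k l → PathTo k l ↔ Fin (#paths k l)
paths-↔ zero l = singleton-↔ (path (ups l) (#right-ups l) (#up-ups l))
  (λ P → path-≡ (trans (no-right⇒ups _ (#right-path P)) (cong ups (#up-path P))))
paths-↔ (suc k) zero = singleton-↔ (path (rights (suc k)) (#right-rights (suc k)) (#up-rights (suc k)))
  (λ P → path-≡ (trans (no-up⇒rights _ (#up-path P)) (cong rights (#right-path P))))
paths-↔ (suc k) (suc l) = begin
  PathTo (suc k) (suc l)                              ↔⟨ first-step-↔ k l ⟩
  (PathTo (suc k) l ⊎ PathTo k (suc l))               ↔⟨ paths-↔ (suc k) l ⊎-↔ paths-↔ k (suc l) ⟩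
  (Fin (#paths (suc k) l) ⊎ Fin (#paths k (suc l)))   ↔⟨ +↔⊎ ⟨
  Fin (#paths (suc k) (suc l))                        ∎
  where open EquationalReasoning

data FirstRight : List Step → Set where
  vertical : ∀ j → FirstRight (ups j)
  bend     : ∀ j Q → FirstRight (ups j ++ right ∷ Q)

firstRight : ∀ P → FirstRight P
firstRight []          = vertical 0
firstRight (right ∷ P) = bend 0 P
firstRight (up ∷ P) with firstRight P
... | vertical j = vertical (suc j)
... | bend j Q   = bend (suc j) Q

-- The rotation moves the initial segment  ups j ++ [ right ]  of a path to its end:
-- rotate (ups j ++ right ∷ Q) = Q ++ right ∷ ups j, and vertical paths are fixed.
rotate-acc : ℕ → List Step → List Step
rotate-acc j []          = ups j
rotate-acc j (up ∷ Q)    = rotate-acc (suc j) Q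
rotate-acc j (right ∷ Q) = Q ++ right ∷ ups j

rotate : List Step → List Step
rotate = rotate-acc 0

rotate-acc-ups : ∀ i j X → rotate-acc j (ups i ++ X) ≡ rotate-acc (i + j) X
rotate-acc-ups zero    j X = refl
rotate-acc-ups (suc i) j X = trans (rotate-acc-ups i (suc j) X) (cong (λ z → rotate-acc z X) (+-suc i j))

rotate-vertical : ∀ j → rotate (ups j) ≡ ups j
rotate-vertical j = begin
  rotate (ups j)            ≡⟨ cong rotate (++-identityʳ (ups j)) ⟨
  rotate (ups j ++ [])      ≡⟨ rotate-acc-ups j 0 [] ⟩
  ups (j + 0)               ≡⟨ cong ups (+-identityʳ j) ⟩
  ups j                     ∎
  where open ≡-Reasoning

rotate-bend : ∀ j Q → rotate (ups j ++ right ∷ Q) ≡ Q ++ right ∷ ups j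
rotate-bend j Q = trans (rotate-acc-ups j 0 (right ∷ Q)) (cong (λ z → Q ++ right ∷ ups z) (+-identityʳ j))

reverse-ups : ∀ n → reverse (ups n) ≡ ups n
reverse-ups zero    = refl
reverse-ups (suc n) = begin
  reverse (up ∷ ups n)      ≡⟨ unfold-reverse up (ups n) ⟩
  reverse (ups n) ∷ʳ up     ≡⟨ cong (_∷ʳ up) (reverse-ups n) ⟩
  ups n ∷ʳ up               ≡⟨ snoc-up n ⟩
  up ∷ ups n                ∎
  where
  open ≡-Reasoning
  snoc-up : ∀ n → ups n ∷ʳ up ≡ up ∷ ups n
  snoc-up zero    = refl
  snoc-up (suc n) = cong (up ∷_) (snoc-up n)

reverse-bend : ∀ j Q → reverse (Q ++ right ∷ ups j) ≡ ups j ++ right ∷ reverse Q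
reverse-bend j Q = begin
  reverse (Q ++ right ∷ ups j)               ≡⟨ reverse-++ Q (right ∷ ups j) ⟩
  reverse (right ∷ ups j) ++ reverse Q       ≡⟨ cong (_++ reverse Q) (unfold-reverse right (ups j)) ⟩
  (reverse (ups j) ∷ʳ right) ++ reverse Q    ≡⟨ cong (λ z → (z ∷ʳ right) ++ reverse Q) (reverse-ups j) ⟩
  (ups j ∷ʳ right) ++ reverse Q              ≡⟨ ++-assoc (ups j) [ right ] (reverse Q) ⟩
  ups j ++ right ∷ reverse Q                 ∎
  where open ≡-Reasoning

unrotate : List Step → List Step
unrotate P = reverse (rotate (reverse P))

unrotate-rotate : ∀ P → unrotate (rotate P) ≡ P
unrotate-rotate P with firstRight P
... | vertical j = begin
  reverse (rotate (reverse (rotate (ups j)))) ≡⟨ cong (λ z → reverse (rotate (reverse z))) (rotate-vertical j) ⟩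
  reverse (rotate (reverse (ups j)))          ≡⟨ cong (λ z → reverse (rotate z)) (reverse-ups j) ⟩
  reverse (rotate (ups j))                    ≡⟨ cong reverse (rotate-vertical j) ⟩
  reverse (ups j)                             ≡⟨ reverse-ups j ⟩
  ups j                                       ∎
  where open ≡-Reasoning
... | bend j Q = begin
  reverse (rotate (reverse (rotate (ups j ++ right ∷ Q))))  ≡⟨ cong (λ z → reverse (rotate (reverse z))) (rotate-bend j Q) ⟩
  reverse (rotate (reverse (Q ++ right ∷ ups j)))           ≡⟨ cong (λ z → reverse (rotate z)) (reverse-bend j Q) ⟩
  reverse (rotate (ups j ++ right ∷ reverse Q))             ≡⟨ cong reverse (rotate-bend j (reverse Q)) ⟩
  reverse (reverse Q ++ right ∷ ups j)                      ≡⟨ reverse-bend j (reverse Q) ⟩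
  ups j ++ right ∷ reverse (reverse Q)                      ≡⟨ cong (λ z → ups j ++ right ∷ z) (reverse-involutive Q) ⟩
  ups j ++ right ∷ Q                                        ∎
  where open ≡-Reasoning

rotate-unrotate : ∀ P → rotate (unrotate P) ≡ P
rotate-unrotate P = begin
  rotate (reverse (rotate (reverse P)))                     ≡⟨ reverse-involutive _ ⟨
  reverse (reverse (rotate (reverse (rotate (reverse P))))) ≡⟨ cong reverse (unrotate-rotate (reverse P)) ⟩
  reverse (reverse P)                                       ≡⟨ reverse-involutive P ⟩
  P                                                         ∎
  where open ≡-Reasoning

#up-++ : ∀ A B → #up (A ++ B) ≡ #up A + #up B
#up-++ []          B = refl
#up-++ (up ∷ A)    B = cong suc (#up-++ A B)
#up-++ (right ∷ A) B = #up-++ A B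

#right-++ : ∀ A B → #right (A ++ B) ≡ #right A + #right B
#right-++ []          B = refl
#right-++ (up ∷ A)    B = #right-++ A B
#right-++ (right ∷ A) B = cong suc (#right-++ A B)

rotate-invariant : (c : List Step → ℕ) → (∀ A B → c (A ++ B) ≡ c A + c B) → ∀ P → c (rotate P) ≡ c P
rotate-invariant c c-++ P with firstRight P
... | vertical j = cong c (rotate-vertical j)
... | bend j Q = begin
  c (rotate (ups j ++ right ∷ Q))   ≡⟨ cong c (rotate-bend j Q) ⟩
  c (Q ++ right ∷ ups j)            ≡⟨ c-++ Q (right ∷ ups j) ⟩
  c Q + c (right ∷ ups j)           ≡⟨ cong (c Q +_) (c-++ [ right ] (ups j)) ⟩
  c Q + (c [ right ] + c (ups j))   ≡⟨ +-comm (c Q) _ ⟩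
  (c [ right ] + c (ups j)) + c Q   ≡⟨ cong (_+ c Q) (+-comm (c [ right ]) (c (ups j))) ⟩
  (c (ups j) + c [ right ]) + c Q   ≡⟨ +-assoc (c (ups j)) _ _ ⟩
  c (ups j) + (c [ right ] + c Q)   ≡⟨ cong (c (ups j) +_) (c-++ [ right ] Q) ⟨
  c (ups j) + c (right ∷ Q)         ≡⟨ c-++ (ups j) (right ∷ Q) ⟨
  c (ups j ++ right ∷ Q)            ∎
  where open ≡-Reasoning

module _ {k l : ℕ} where

  rotate-path unrotate-path : PathTo k l → PathTo k l
  rotate-path P = path (rotate (proj₁ P))
    (trans (rotate-invariant #right #right-++ (proj₁ P)) (#right-path P))
    (trans (rotate-invariant #up #up-++ (proj₁ P)) (#up-path P))
  unrotate-path P = path (unrotate (proj₁ P))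
    (trans (sym (rotate-invariant #right #right-++ (unrotate (proj₁ P))))
           (trans (cong #right (rotate-unrotate (proj₁ P))) (#right-path P)))
    (trans (sym (rotate-invariant #up #up-++ (unrotate (proj₁ P))))
           (trans (cong #up (rotate-unrotate (proj₁ P))) (#up-path P)))

  rotate-↔ : PathTo k l ↔ PathTo k l
  rotate-↔ = mk↔ₛ′ rotate-path unrotate-path
    (λ P → path-≡ (rotate-unrotate (proj₁ P))) (λ P → path-≡ (unrotate-rotate (proj₁ P)))

-- upsBefore d P is the number of up-steps P takes before its d-th right-step; it is the
-- height at which P leaves the strip x < d.  Domination is a condition on these numbers.
upsBefore : ℕ → List Step → ℕ
upsBefore zero    P           = 0
upsBefore (suc d) []          = 0
upsBefore (suc d) (up ∷ P)    = suc (upsBefore (suc d) P)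
upsBefore (suc d) (right ∷ P) = upsBefore d P

upsBefore-≤ : ∀ d P → upsBefore d P ≤ #up P
upsBefore-≤ zero    P           = z≤n
upsBefore-≤ (suc d) []          = z≤n
upsBefore-≤ (suc d) (up ∷ P)    = s≤s (upsBefore-≤ (suc d) P)
upsBefore-≤ (suc d) (right ∷ P) = upsBefore-≤ d P

upsBefore-all : ∀ d P → #right P < d → upsBefore d P ≡ #up P
upsBefore-all (suc d) []          _       = refl
upsBefore-all (suc d) (up ∷ P)    h       = cong suc (upsBefore-all (suc d) P h)
upsBefore-all (suc d) (right ∷ P) (s≤s h) = upsBefore-all d P h

upsBefore-mono : ∀ {d d′} P → d ≤ d′ → upsBefore d P ≤ upsBefore d′ P
upsBefore-mono P           z≤n     = z≤n
upsBefore-mono []          (s≤s h) = z≤n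
upsBefore-mono (up ∷ P)    (s≤s h) = s≤s (upsBefore-mono P (s≤s h))
upsBefore-mono (right ∷ P) (s≤s h) = upsBefore-mono P h

upsBefore-++ : ∀ d Q X → d ≤ suc (#right Q) → upsBefore d (Q ++ right ∷ X) ≡ upsBefore d Q
upsBefore-++ zero          Q           X _       = refl
upsBefore-++ (suc zero)    []          X _       = refl
upsBefore-++ (suc (suc d)) []          X (s≤s ())
upsBefore-++ (suc d)       (up ∷ Q)    X h       = cong suc (upsBefore-++ (suc d) Q X h)
upsBefore-++ (suc d)       (right ∷ Q) X (s≤s h) = upsBefore-++ d Q X h

upsBefore-ups : ∀ d j X → upsBefore (suc d) (ups j ++ X) ≡ j + upsBefore (suc d) X
upsBefore-ups d zero    X = refl
upsBefore-ups d (suc j) X = cong suc (upsBefore-ups d j X)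

upsBefore-rotate : ∀ d P → d ≤ #right P → upsBefore d (rotate P) ≡ upsBefore (suc d) P ∸ upsBefore 1 P
upsBefore-rotate d P h with firstRight P
upsBefore-rotate d .(ups j) h | vertical j
  with z≤n ← subst (d ≤_) (#right-ups j) h = sym (n∸n≡0 (upsBefore 1 (ups j)))
upsBefore-rotate d .(ups j ++ right ∷ Q) h | bend j Q = begin
  upsBefore d (rotate (ups j ++ right ∷ Q))  ≡⟨ cong (upsBefore d) (rotate-bend j Q) ⟩
  upsBefore d (Q ++ right ∷ ups j)           ≡⟨ upsBefore-++ d Q (ups j) d≤ ⟩
  upsBefore d Q                              ≡⟨ [m+n]∸[m+o]≡n∸o j (upsBefore d Q) 0 ⟨
  (j + upsBefore d Q) ∸ (j + 0)              ≡⟨ cong₂ _∸_ (upsBefore-ups d j (right ∷ Q)) (upsBefore-ups 0 j (right ∷ Q)) ⟨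
  upsBefore (suc d) (ups j ++ right ∷ Q) ∸ upsBefore 1 (ups j ++ right ∷ Q) ∎
  where
  open ≡-Reasoning
  d≤ : d ≤ suc (#right Q)
  d≤ = subst (d ≤_) (trans (#right-++ (ups j) (right ∷ Q)) (cong (_+ suc (#right Q)) (#right-ups j))) h

-- Rotating a times moves the first a right-steps (with the up-steps before them) to the end.
rotate^ : ℕ → List Step → List Step
rotate^ zero    P = P
rotate^ (suc a) P = rotate^ a (rotate P)

rotate^-invariant : (c : List Step → ℕ) → (∀ A B → c (A ++ B) ≡ c A + c B) → ∀ a P → c (rotate^ a P) ≡ c P
rotate^-invariant c c-++ zero    P = refl
rotate^-invariant c c-++ (suc a) P = trans (rotate^-invariant c c-++ a (rotate P)) (rotate-invariant c c-++ P)

upsBefore-rotate^ : ∀ a d P → a + d ≤ suc (#right P) →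
  upsBefore d (rotate^ a P) ≡ upsBefore (a + d) P ∸ upsBefore a P
upsBefore-rotate^ zero    d P h       = refl
upsBefore-rotate^ (suc a) d P (s≤s h) = begin
  upsBefore d (rotate^ a (rotate P))
    ≡⟨ upsBefore-rotate^ a d (rotate P) (subst (λ z → a + d ≤ suc z) (sym (rotate-invariant #right #right-++ P)) (m≤n⇒m≤1+n h)) ⟩
  upsBefore (a + d) (rotate P) ∸ upsBefore a (rotate P)
    ≡⟨ cong₂ _∸_ (upsBefore-rotate (a + d) P h) (upsBefore-rotate a P (≤-trans (m≤m+n a d) h)) ⟩
  (upsBefore (suc (a + d)) P ∸ upsBefore 1 P) ∸ (upsBefore (suc a) P ∸ upsBefore 1 P)
    ≡⟨ ∸-∸-cancel (upsBefore-mono P (s≤s z≤n)) ⟩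
  upsBefore (suc a + d) P ∸ upsBefore (suc a) P ∎
  where
  open ≡-Reasoning
  ∸-∸-cancel : ∀ {x y c} → c ≤ y → (x ∸ c) ∸ (y ∸ c) ≡ x ∸ y
  ∸-∸-cancel {x} {y} {c} c≤y = trans (∸-+-assoc x c (y ∸ c)) (cong (x ∸_) (m+[n∸m]≡n c≤y))

module Enumeration (k l : ℕ) where
  open Inverse (paths-↔ k l) using (strictlyInverseʳ) renaming (from to pathAt)

  N : ℕ
  N = #paths k l

  path# : Fin N → List Step
  path# x = proj₁ (pathAt x)

  #right-path# : ∀ x → #right (path# x) ≡ k
  #right-path# x = #right-path (pathAt x)

  #up-path# : ∀ x → #up (path# x) ≡ l
  #up-path# x = #up-path (pathAt x)

  ∑-rotate : ∀ (g : List Step → ℕ) → ∑[ x < N ] g (rotate (path# x)) ≡ ∑[ x < N ] g (path# x)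
  ∑-rotate g = begin
    ∑[ x < N ] g (rotate (path# x))            ≡⟨ sum-cong-≗ (λ x → cong (λ P → g (proj₁ P)) (strictlyInverseʳ (rotate-path (pathAt x)))) ⟨
    ∑[ x < N ] g (path# (π ⟨$⟩ʳ x))            ≡⟨ ∑-permute (λ x → g (path# x)) π ⟨
    ∑[ x < N ] g (path# x)                     ∎
    where
    open ≡-Reasoning
    π : Permutation N N
    π = ↔-trans (↔-sym (paths-↔ k l)) (↔-trans rotate-↔ (paths-↔ k l))

  ∑-rotate^ : ∀ a (g : List Step → ℕ) → ∑[ x < N ] g (rotate^ a (path# x)) ≡ ∑[ x < N ] g (path# x)
  ∑-rotate^ zero    g = refl
  ∑-rotate^ (suc a) g = trans (∑-rotate (λ P → g (rotate^ a P))) (∑-rotate^ a g)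

-- A path P started at (x₀ , y₀) stays weakly right of the curve x = T y above its start
-- iff, for each 1 ≤ y ≤ #up P, it climbs fewer than y steps before reaching x = T (y₀ + y).
ClearOf : (ℕ → ℕ) → ℕ → ℕ → List Step → Set
ClearOf T x₀ y₀ P = ∀ y → 1 ≤ y → y ≤ #up P → upsBefore (T (y₀ + y) ∸ x₀) P < y

≤ᵇ-true⇒≤ : ∀ {m n} → (m ≤ᵇ n) ≡ true → m ≤ n
≤ᵇ-true⇒≤ {m} {n} e = ≤ᵇ⇒≤ m n (Equivalence.from T-≡ e)

≤⇒≤ᵇ-true : ∀ {m n} → m ≤ n → (m ≤ᵇ n) ≡ true
≤⇒≤ᵇ-true h = Equivalence.to T-≡ (≤⇒≤ᵇ h)

∧-true : ∀ {a b} → a ∧ b ≡ true → a ≡ true × b ≡ true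
∧-true {true} {true} _ = refl , refl

upsBefore-right : ∀ d Q → upsBefore d (right ∷ Q) ≡ upsBefore (d ∸ 1) Q
upsBefore-right zero    Q = refl
upsBefore-right (suc d) Q = refl

upsBefore-up≤ : ∀ d Q → upsBefore d (up ∷ Q) ≤ suc (upsBefore d Q)
upsBefore-up≤ zero    Q = z≤n
upsBefore-up≤ (suc d) Q = ≤-refl

upsBefore-up< : ∀ d Q {y} → 1 ≤ y → upsBefore d (up ∷ Q) < suc y → upsBefore d Q < y
upsBefore-up< zero    Q 1≤y _       = 1≤y
upsBefore-up< (suc d) Q _   (s≤s h) = h

∸-suc : ∀ t x → (t ∸ x) ∸ 1 ≡ t ∸ suc x
∸-suc t x = trans (∸-+-assoc t x 1) (cong (t ∸_) (+-comm x 1))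

-- Domination as a condition on upsBefore.  The test is a parameter so that it can be
-- instantiated with the anonymous test inside  dominated.
module Domination (T : ℕ → ℕ) (right-of : ℕ × ℕ → Bool)
                  (right-of-spec : ∀ x y → right-of (x , y) ≡ (T y ≤ᵇ x)) where

  right-of⇒≤ : ∀ {x y} → right-of (x , y) ≡ true → T y ≤ x
  right-of⇒≤ {x} {y} e = ≤ᵇ-true⇒≤ (trans (sym (right-of-spec x y)) e)

  all-right-of⇒clear : ∀ x₀ y₀ P → all right-of (pointsFrom (x₀ , y₀) P) ≡ true →
                       T y₀ ≤ x₀ × ClearOf T x₀ y₀ P
  all-right-of⇒clear x₀ y₀ [] e = right-of⇒≤ (proj₁ (∧-true e)) , λ { zero () _ ; (suc y) _ () }
  all-right-of⇒clear x₀ y₀ (up ∷ Q) e with ∧-true {right-of (x₀ , y₀)} e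
  ... | e₀ , e-rest with all-right-of⇒clear x₀ (suc y₀) Q e-rest
  ... | T≤ , clear = right-of⇒≤ e₀ , clear′
    where
    clear′ : ClearOf T x₀ y₀ (up ∷ Q)
    clear′ (suc zero) _ _ rewrite +-comm y₀ 1 | m≤n⇒m∸n≡0 T≤ = s≤s z≤n
    clear′ (suc (suc y)) _ (s≤s h) =
      ≤-trans (s≤s (upsBefore-up≤ (T (y₀ + suc (suc y)) ∸ x₀) Q))
        (s≤s (subst (λ z → upsBefore (T z ∸ x₀) Q < suc y) (sym (+-suc y₀ (suc y))) (clear (suc y) (s≤s z≤n) h)))
  all-right-of⇒clear x₀ y₀ (right ∷ Q) e with ∧-true {right-of (x₀ , y₀)} e
  ... | e₀ , e-rest with all-right-of⇒clear (suc x₀) y₀ Q e-rest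
  ... | _ , clear = right-of⇒≤ e₀ , clear′
    where
    clear′ : ClearOf T x₀ y₀ (right ∷ Q)
    clear′ y h₁ h₂ rewrite upsBefore-right (T (y₀ + y) ∸ x₀) Q | ∸-suc (T (y₀ + y)) x₀ = clear y h₁ h₂

  -- Conversely; at an up-step, clearance at height y₀ + 1 places the next point right of the curve.
  clear⇒all-right-of : ∀ x₀ y₀ P → T y₀ ≤ x₀ → ClearOf T x₀ y₀ P →
                       all right-of (pointsFrom (x₀ , y₀) P) ≡ true
  clear⇒all-right-of x₀ y₀ [] T≤ _ rewrite right-of-spec x₀ y₀ | ≤⇒≤ᵇ-true T≤ = refl
  clear⇒all-right-of x₀ y₀ (up ∷ Q) T≤ clear rewrite right-of-spec x₀ y₀ | ≤⇒≤ᵇ-true T≤ =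
    clear⇒all-right-of x₀ (suc y₀) Q T≤′ clear′
    where
    first-step : upsBefore (T (y₀ + 1) ∸ x₀) (up ∷ Q) < 1
    first-step = clear 1 (s≤s z≤n) (s≤s z≤n)
    no-ups⇒zero : ∀ d → upsBefore d (up ∷ Q) < 1 → d ≡ 0
    no-ups⇒zero zero    _        = refl
    no-ups⇒zero (suc d) (s≤s ())
    T≤′ : T (suc y₀) ≤ x₀
    T≤′ = subst (λ z → T z ≤ x₀) (+-comm y₀ 1) (m∸n≡0⇒m≤n (no-ups⇒zero _ first-step))
    clear′ : ClearOf T x₀ (suc y₀) Q
    clear′ y h₁ h₂ = upsBefore-up< (T (suc (y₀ + y)) ∸ x₀) Q h₁
      (subst (λ z → upsBefore (T z ∸ x₀) (up ∷ Q) < suc y) (+-suc y₀ y) (clear (suc y) (s≤s z≤n) (s≤s h₂)))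
  clear⇒all-right-of x₀ y₀ (right ∷ Q) T≤ clear rewrite right-of-spec x₀ y₀ | ≤⇒≤ᵇ-true T≤ =
    clear⇒all-right-of (suc x₀) y₀ Q (m≤n⇒m≤1+n T≤) clear′
    where
    clear′ : ClearOf T (suc x₀) y₀ Q
    clear′ y h₁ h₂ = subst (_< y) (trans (upsBefore-right (T (y₀ + y) ∸ x₀) Q) (cong (λ z → upsBefore z Q) (∸-suc (T (y₀ + y)) x₀))) (clear y h₁ h₂)

-- The excess of a sequence c over the bounds c y < y (1 ≤ y ≤ L):
-- excess L c = max (0, c y − y + 1), which vanishes iff all bounds hold, and
-- excess⁻ L c = max (0, c y − y) = excess L c ∸ 1.
excess excess⁻ : ℕ → (ℕ → ℕ) → ℕ
excess zero    c = 0
excess (suc L) c = excess L c ⊔ (c (suc L) ∸ L)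
excess⁻ zero    c = 0
excess⁻ (suc L) c = excess⁻ L c ⊔ (c (suc L) ∸ suc L)

excess⁻≡excess∸1 : ∀ L c → excess⁻ L c ≡ excess L c ∸ 1
excess⁻≡excess∸1 zero    c = refl
excess⁻≡excess∸1 (suc L) c = sym (begin
  (excess L c ⊔ (c (suc L) ∸ L)) ∸ 1          ≡⟨ ∸-distribʳ-⊔ 1 (excess L c) (c (suc L) ∸ L) ⟩
  (excess L c ∸ 1) ⊔ ((c (suc L) ∸ L) ∸ 1)    ≡⟨ cong₂ _⊔_ (excess⁻≡excess∸1 L c) (sym (∸-suc (c (suc L)) L)) ⟨
  excess⁻ L c ⊔ (c (suc L) ∸ suc L)           ∎)
  where open ≡-Reasoning

excess≡0⇒bounded : ∀ L c → excess L c ≡ 0 → ∀ y → 1 ≤ y → y ≤ L → c y < y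
excess≡0⇒bounded zero    c e (suc y) 1≤y ()
excess≡0⇒bounded (suc L) c e y 1≤y y≤ with m≤n⇒m<n∨m≡n y≤
... | inj₁ (s≤s y≤L) = excess≡0⇒bounded L c (n≤0⇒n≡0 (subst (excess L c ≤_) e (m≤m⊔n _ _))) y 1≤y y≤L
... | inj₂ refl      = s≤s (m∸n≡0⇒m≤n (n≤0⇒n≡0 (subst (c (suc L) ∸ L ≤_) e (m≤n⊔m (excess L c) _))))

bounded⇒excess≡0 : ∀ L c → (∀ y → 1 ≤ y → y ≤ L → c y < y) → excess L c ≡ 0
bounded⇒excess≡0 zero    c h = refl
bounded⇒excess≡0 (suc L) c h = cong₂ _⊔_ (bounded⇒excess≡0 L c (λ y 1≤y y≤L → h y 1≤y (m≤n⇒m≤1+n y≤L)))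
  (m≤n⇒m∸n≡0 (≤-pred (h (suc L) (s≤s z≤n) ≤-refl)))

excess-cong : ∀ L c c′ → (∀ y → 1 ≤ y → y ≤ L → c y ≡ c′ y) → excess L c ≡ excess L c′
excess-cong zero    c c′ h = refl
excess-cong (suc L) c c′ h = cong₂ _⊔_ (excess-cong L c c′ (λ y 1≤y y≤L → h y 1≤y (m≤n⇒m≤1+n y≤L)))
  (cong (_∸ L) (h (suc L) (s≤s z≤n) ≤-refl))

excess⁻-cong : ∀ L c c′ → (∀ y → 1 ≤ y → y ≤ L → c y ≡ c′ y) → excess⁻ L c ≡ excess⁻ L c′
excess⁻-cong L c c′ h = trans (excess⁻≡excess∸1 L c) (trans (cong (_∸ 1) (excess-cong L c c′ h)) (sym (excess⁻≡excess∸1 L c′)))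

+-∸-⊔ : ∀ h x p → h ≤ x → h + ((x ∸ h) ∸ p) ≡ h ⊔ (x ∸ p)
+-∸-⊔ h x p h≤x with ≤-total p (x ∸ h)
... | inj₁ p≤ = sym (trans (m≤n⇒m⊔n≡n h≤x∸p) x∸p≡)
  where
  x∸p≡ : x ∸ p ≡ h + ((x ∸ h) ∸ p)
  x∸p≡ = trans (cong (_∸ p) (sym (m+[n∸m]≡n h≤x))) (+-∸-assoc h p≤)
  h≤x∸p : h ≤ x ∸ p
  h≤x∸p = subst (h ≤_) (sym x∸p≡) (m≤m+n h _)
... | inj₂ ≤p = trans (cong (h +_) (m≤n⇒m∸n≡0 ≤p)) (trans (+-identityʳ h) (sym (m≥n⇒m⊔n≡m x∸p≤h)))
  where
  x∸p≤h : x ∸ p ≤ h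
  x∸p≤h = ≤-trans (∸-monoʳ-≤ x ≤p) (≤-reflexive (m∸[m∸n]≡n h≤x))

excess-≥-first : ∀ L c → c 1 ≤ excess (suc L) c
excess-≥-first zero    c = ≤-refl
excess-≥-first (suc L) c = ≤-trans (excess-≥-first L c) (m≤m⊔n _ _)

excess-drop-first : ∀ L c h → h ≡ c 1 → (∀ y → 1 ≤ y → h ≤ c y) →
                    h + excess⁻ L (λ y → c (suc y) ∸ h) ≡ excess (suc L) c
excess-drop-first zero    c h h≡ h≤ = trans (+-identityʳ h) h≡
excess-drop-first (suc L) c h h≡ h≤ = begin
  h + (excess⁻ L d ⊔ (d (suc L) ∸ suc L))                     ≡⟨ +-distribˡ-⊔ h (excess⁻ L d) _ ⟩
  (h + excess⁻ L d) ⊔ (h + ((c (2 + L) ∸ h) ∸ suc L))          ≡⟨ cong₂ _⊔_ (excess-drop-first L c h h≡ h≤)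
                                                                           (+-∸-⊔ h _ (suc L) (h≤ _ (s≤s z≤n))) ⟩
  E ⊔ (h ⊔ (c (2 + L) ∸ suc L))                                ≡⟨ ⊔-assoc E h _ ⟨
  (E ⊔ h) ⊔ (c (2 + L) ∸ suc L)                                ≡⟨ cong (_⊔ (c (2 + L) ∸ suc L))
                                                                       (m≥n⇒m⊔n≡m (subst (_≤ E) (sym h≡) (excess-≥-first L c))) ⟩
  E ⊔ (c (2 + L) ∸ suc L)                                      ∎
  where
  open ≡-Reasoning
  d : ℕ → ℕ
  d y = c (suc y) ∸ h
  E : ℕ
  E = excess (suc L) c

excess-step : ∀ L c c′ h → (L ≡ 0 → h ≡ 0) → h ≡ c 1 → (∀ y → 1 ≤ y → h ≤ c y) →
              (∀ y → 1 ≤ y → suc y ≤ L → c′ y ≡ c (suc y) ∸ h) → c′ L ≤ L →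
              h + excess⁻ L c′ ≡ excess L c
excess-step zero    c c′ h h≡0 _ _ _ _ = trans (+-identityʳ h) (h≡0 refl)
excess-step (suc L) c c′ h _ h≡ h≤ c′≡ c′L≤ = begin
  h + (excess⁻ L c′ ⊔ (c′ (suc L) ∸ suc L))      ≡⟨ cong (λ w → h + (excess⁻ L c′ ⊔ w)) (m≤n⇒m∸n≡0 c′L≤) ⟩
  h + (excess⁻ L c′ ⊔ 0)                         ≡⟨ cong (h +_) (⊔-identityʳ (excess⁻ L c′)) ⟩
  h + excess⁻ L c′                               ≡⟨ cong (h +_) (excess⁻-cong L c′ _ (λ y 1≤y y≤L → c′≡ y 1≤y (s≤s y≤L))) ⟩
  h + excess⁻ L (λ y → c (suc y) ∸ h)            ≡⟨ excess-drop-first L c h h≡ h≤ ⟩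
  excess (suc L) c                               ∎
  where open ≡-Reasoning

sumTo : ℕ → (ℕ → ℕ) → ℕ
sumTo zero    f = 0
sumTo (suc y) f = sumTo y f + f y

sumTo-cong : ∀ y f g → (∀ s → s < y → f s ≡ g s) → sumTo y f ≡ sumTo y g
sumTo-cong zero    f g h = refl
sumTo-cong (suc y) f g h = cong₂ _+_ (sumTo-cong y f g (λ s s<y → h s (m≤n⇒m≤1+n s<y))) (h y ≤-refl)

sumTo-suc : ∀ y f → sumTo (suc y) f ≡ f 0 + sumTo y (λ s → f (suc s))
sumTo-suc zero    f = +-comm 0 (f 0)
sumTo-suc (suc y) f = trans (cong (_+ f (suc y)) (sumTo-suc y f)) (+-assoc (f 0) _ _)

sumTo-mono : ∀ f {y y′} → y ≤ y′ → sumTo y f ≤ sumTo y′ f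
sumTo-mono f {y′ = zero}   z≤n = ≤-refl
sumTo-mono f {y′ = suc y′} y≤ with m≤n⇒m<n∨m≡n y≤
... | inj₁ (s≤s y≤y′) = ≤-trans (sumTo-mono f y≤y′) (m≤m+n _ _)
... | inj₂ refl       = ≤-refl

sumTo-+ : ∀ y f g → sumTo y (λ s → f s + g s) ≡ sumTo y f + sumTo y g
sumTo-+ zero    f g = refl
sumTo-+ (suc y) f g = trans (cong (_+ (f y + g y)) (sumTo-+ y f g)) (interchange (sumTo y f) (sumTo y g) (f y) (g y))

sumTo-*ʳ : ∀ y f c → sumTo y (λ s → f s * c) ≡ sumTo y f * c
sumTo-*ʳ zero    f c = refl
sumTo-*ʳ (suc y) f c = trans (cong (_+ f y * c) (sumTo-*ʳ y f c)) (sym (*-distribʳ-+ c (sumTo y f) (f y)))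

sumTo-const : ∀ y c → sumTo y (λ _ → c) ≡ y * c
sumTo-const zero    c = refl
sumTo-const (suc y) c = trans (+-comm (sumTo y (λ _ → c)) c) (cong (c +_) (sumTo-const y c))

sumTo-rotate : ∀ M G → G M ≡ G 0 → sumTo M (λ r → G (suc r)) ≡ sumTo M G
sumTo-rotate M G GM≡G0 = +-cancelʳ-≡ _ _ _ (trans (shift M) (cong (sumTo M G +_) GM≡G0))
  where
  shift : ∀ M → sumTo M (λ r → G (suc r)) + G 0 ≡ sumTo M G + G M
  shift zero    = refl
  shift (suc M) = begin
    sumTo M (λ r → G (suc r)) + G (suc M) + G 0     ≡⟨ +-assoc (sumTo M _) _ _ ⟩
    sumTo M (λ r → G (suc r)) + (G (suc M) + G 0)   ≡⟨ cong (sumTo M (λ r → G (suc r)) +_) (+-comm (G (suc M)) (G 0)) ⟩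
    sumTo M (λ r → G (suc r)) + (G 0 + G (suc M))   ≡⟨ +-assoc (sumTo M _) _ _ ⟨
    sumTo M (λ r → G (suc r)) + G 0 + G (suc M)     ≡⟨ cong (_+ G (suc M)) (shift M) ⟩
    sumTo M G + G M + G (suc M)                     ∎
    where open ≡-Reasoning

∑-toℕ : ∀ n g → ∑[ i < n ] g (toℕ i) ≡ sumTo n g
∑-toℕ zero    g = refl
∑-toℕ (suc n) g = trans (cong (g 0 +_) (∑-toℕ n (λ s → g (suc s)))) (sym (sumTo-suc n g))

∑-reverse : ∀ n (F : ℕ → ℕ) → ∑[ j < n ] F (n ∸ toℕ j) ≡ sumTo n (λ r → F (suc r))
∑-reverse zero    F = refl
∑-reverse (suc n) F = trans (cong (F (suc n) +_) (∑-reverse n F)) (+-comm (F (suc n)) _)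

∑-const : ∀ n c → ∑[ i < n ] c ≡ n * c
∑-const zero    c = refl
∑-const (suc n) c = cong (c +_) (∑-const n c)

total≡∑ : ∀ {n} (a : Fin n → ℕ) → total a ≡ ∑[ i < n ] a i
total≡∑ {zero}  a = refl
total≡∑ {suc n} a = cong (a Fin.zero +_) (begin
  sum (map a (tabulate Fin.suc))                ≡⟨ cong sum (map-tabulate Fin.suc a) ⟩
  sum (tabulate (λ i → a (Fin.suc i)))          ≡⟨ cong sum (map-tabulate (λ i → i) (λ i → a (Fin.suc i))) ⟨
  sum (map (λ i → a (Fin.suc i)) (allFin n))    ≡⟨ total≡∑ (λ i → a (Fin.suc i)) ⟩
  ∑[ i < n ] a (Fin.suc i)                      ∎)
  where open ≡-Reasoning

bdry≡sumTo : ∀ {n} (b : Fin n → ℕ) (f : ℕ → ℕ) → (∀ i → b i ≡ f (toℕ i)) → ∀ y → y ≤ n → bdry b y ≡ sumTo y f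
bdry≡sumTo {zero}  b f e zero    _       = refl
bdry≡sumTo {suc n} b f e zero    _       = refl
bdry≡sumTo {suc n} b f e (suc y) (s≤s h) =
  trans (cong₂ _+_ (e Fin.zero) (bdry≡sumTo (λ i → b (Fin.suc i)) (λ s → f (suc s)) (λ i → e (Fin.suc i)) y h))
        (sym (sumTo-suc y f))

module Composition (m′ : ℕ) (a : Fin (suc m′) → ℕ) where
  M : ℕ
  M = suc m′

  α : ℕ → ℕ
  α s = a (s mod M)

  α-periodic : ∀ s → α (M + s) ≡ α s
  α-periodic s = cong a (toℕ-injective (begin
    toℕ ((M + s) mod M)   ≡⟨ toℕ-fromℕ< _ ⟩
    (M + s) % M           ≡⟨ cong (_% M) (+-comm M s) ⟩
    (s + M) % M           ≡⟨ [m+n]%n≡m%n s M ⟩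
    s % M                 ≡⟨ toℕ-fromℕ< _ ⟨
    toℕ (s mod M)         ∎))
    where open ≡-Reasoning

  α-toℕ : ∀ i → a i ≡ α (toℕ i)
  α-toℕ i = cong a (sym (toℕ-injective (trans (toℕ-fromℕ< _) (m<n⇒m%n≡m (toℕ<n i)))))

  bd : ℕ → ℕ → ℕ
  bd r y = sumTo y (λ s → α (r + s))

  bd-suc : ∀ r y → bd r (suc y) ≡ α r + bd (suc r) y
  bd-suc r y = trans (sumTo-suc y (λ s → α (r + s)))
    (cong₂ _+_ (cong α (+-identityʳ r)) (sumTo-cong y _ _ (λ s _ → cong α (+-suc r s))))

  bd-1 : ∀ r → bd r 1 ≡ α r
  bd-1 r = cong α (+-identityʳ r)

  bd-mono : ∀ r {y y′} → y ≤ y′ → bd r y ≤ bd r y′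
  bd-mono r = sumTo-mono (λ s → α (r + s))

  bd-periodic : ∀ y → bd M y ≡ bd 0 y
  bd-periodic y = sumTo-cong y _ _ (λ s _ → α-periodic s)

  total≡sumTo : total a ≡ sumTo M α
  total≡sumTo = trans (total≡∑ a) (trans (sum-cong-≗ α-toℕ) (∑-toℕ M α))

  bdry-cshift : ∀ (j : Fin M) y → y ≤ M → bdry (cshift j a) y ≡ bd (M ∸ toℕ j) y
  bdry-cshift j = bdry≡sumTo (cshift j a) (λ s → α ((M ∸ toℕ j) + s)) shift-entry
    where
    shift-entry : ∀ i → cshift j a i ≡ α ((M ∸ toℕ j) + toℕ i)
    shift-entry i = cong α (trans (+-∸-assoc (toℕ i) (<⇒≤ (toℕ<n j))) (+-comm (toℕ i) _))

isZero : ℕ → ℕ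
isZero zero    = 1
isZero (suc _) = 0

∸1+1 : ∀ v → v ∸ 1 + 1 ≡ v + isZero v
∸1+1 zero    = refl
∸1+1 (suc v) = trans (+-comm v 1) (sym (+-identityʳ (suc v)))

δ : Bool → Bool → ℕ
δ true  true  = 1
δ false false = 1
δ true  false = 0
δ false true  = 0

δ-true+δ-false : ∀ c → δ true c + δ false c ≡ 1
δ-true+δ-false true  = refl
δ-true+δ-false false = refl

δ-true≡isZero : ∀ c v → (c ≡ true → v ≡ 0) → (v ≡ 0 → c ≡ true) → δ true c ≡ isZero v
δ-true≡isZero true  zero    _ _ = refl
δ-true≡isZero true  (suc v) f _ with () ← f refl
δ-true≡isZero false zero    _ g with () ← g refl
δ-true≡isZero false (suc v) _ _ = refl

≡-↔-δ : ∀ b c → (c ≡ b) ↔ Fin (δ b c)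
≡-↔-δ true  true  = singleton-↔ refl (λ { refl → refl })
≡-↔-δ false false = singleton-↔ refl (λ { refl → refl })
≡-↔-δ true  false = mk↔ₛ′ (λ ()) (λ ()) (λ ()) (λ ())
≡-↔-δ false true  = mk↔ₛ′ (λ ()) (λ ()) (λ ()) (λ ())

Σ-Fin-↔ : ∀ n (c : Fin n → ℕ) → Σ (Fin n) (λ i → Fin (c i)) ↔ Fin (∑[ i < n ] c i)
Σ-Fin-↔ zero c = mk↔ₛ′ (λ { (() , _) }) (λ ()) (λ ()) (λ { (() , _) })
Σ-Fin-↔ (suc n) c = begin
  Σ (Fin (suc n)) (λ i → Fin (c i))                        ↔⟨ split-first ⟩
  (Fin (c Fin.zero) ⊎ Σ (Fin n) (λ i → Fin (c (Fin.suc i)))) ↔⟨ ↔-refl ⊎-↔ Σ-Fin-↔ n (λ i → c (Fin.suc i)) ⟩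
  (Fin (c Fin.zero) ⊎ Fin (∑[ i < n ] c (Fin.suc i)))      ↔⟨ +↔⊎ ⟨
  Fin (c Fin.zero + ∑[ i < n ] c (Fin.suc i))              ∎
  where
  open EquationalReasoning
  split-first : Σ (Fin (suc n)) (λ i → Fin (c i)) ↔ (Fin (c Fin.zero) ⊎ Σ (Fin n) (λ i → Fin (c (Fin.suc i))))
  split-first = mk↔ₛ′
    (λ { (Fin.zero , y) → inj₁ y ; (Fin.suc i , y) → inj₂ (i , y) })
    (λ { (inj₁ y) → Fin.zero , y ; (inj₂ (i , y)) → Fin.suc i , y })
    (λ { (inj₁ y) → refl ; (inj₂ (i , y)) → refl })
    (λ { (Fin.zero , y) → refl ; (Fin.suc i , y) → refl })

count-↔ : ∀ m n (f : Fin m → Fin n → Bool) b →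
          Σ (Fin m × Fin n) (λ p → f (proj₁ p) (proj₂ p) ≡ b) ↔ Fin (∑[ i < m ] ∑[ j < n ] δ b (f i j))
count-↔ m n f b = begin
  Σ (Fin m × Fin n) (λ p → f (proj₁ p) (proj₂ p) ≡ b)        ↔⟨ Σ-assoc ⟩
  Σ (Fin m) (λ i → Σ (Fin n) (λ j → f i j ≡ b))              ↔⟨ Σ-↔ ↔-refl (Σ-↔ ↔-refl (≡-↔-δ b _)) ⟩
  Σ (Fin m) (λ i → Σ (Fin n) (λ j → Fin (δ b (f i j))))      ↔⟨ Σ-↔ ↔-refl (Σ-Fin-↔ n _) ⟩
  Σ (Fin m) (λ i → Fin (∑[ j < n ] δ b (f i j)))             ↔⟨ Σ-Fin-↔ m _ ⟩
  Fin (∑[ i < m ] ∑[ j < n ] δ b (f i j))                    ∎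
  where open EquationalReasoning

module Counting (m′ : ℕ) (a : Fin (suc m′) → ℕ) (k l : ℕ) (l≤M : l ≤ suc m′)
                (bd≤ : ∀ r → r ≤ suc m′ → Composition.bd m′ a r l ≤ suc k) where
  open Composition m′ a
  open Enumeration k l

  -- The violation of P against the boundary read from r (zero iff P is dominated by it), the
  -- potential (one less), and the climb of P before the first column x = α r of that boundary.
  violation potential climb : ℕ → List Step → ℕ
  violation r P = excess  l (λ y → upsBefore (bd r y) P)
  potential r P = excess⁻ l (λ y → upsBefore (bd r y) P)
  climb     r P = upsBefore (α r) P

  -- Rotating P past its first α r right-steps turns the boundary read from r into the one
  -- read from r + 1, and the potential against the new boundary loses exactly the climb.
  violation-step : ∀ r P → r ≤ M → #right P ≡ k → #up P ≡ l →
                   climb r P + potential (suc r) (rotate^ (α r) P) ≡ violation r P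
  violation-step r P r≤M #r #u = excess-step l c c′ (climb r P) climb≡0 climb≡c1 climb≤ c′≡ c′l≤l
    where
    c c′ : ℕ → ℕ
    c y  = upsBefore (bd r y) P
    c′ y = upsBefore (bd (suc r) y) (rotate^ (α r) P)
    climb≡0 : l ≡ 0 → climb r P ≡ 0
    climb≡0 l≡0 = n≤0⇒n≡0 (subst (climb r P ≤_) (trans #u l≡0) (upsBefore-≤ (α r) P))
    climb≡c1 : climb r P ≡ c 1
    climb≡c1 = cong (λ d → upsBefore d P) (sym (bd-1 r))
    climb≤ : ∀ y → 1 ≤ y → climb r P ≤ c y
    climb≤ y 1≤y = upsBefore-mono P (subst (_≤ bd r y) (bd-1 r) (bd-mono r 1≤y))
    c′≡ : ∀ y → 1 ≤ y → suc y ≤ l → c′ y ≡ c (suc y) ∸ climb r P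
    c′≡ y _ y<l = trans (upsBefore-rotate^ (α r) (bd (suc r) y) P in-range)
                        (cong (λ d → upsBefore d P ∸ climb r P) (sym (bd-suc r y)))
      where
      in-range : α r + bd (suc r) y ≤ suc (#right P)
      in-range = subst₂ _≤_ (bd-suc r y) (cong suc (sym #r)) (≤-trans (bd-mono r y<l) (bd≤ r r≤M))
    c′l≤l : c′ l ≤ l
    c′l≤l = subst (c′ l ≤_) (trans (rotate^-invariant #up #up-++ (α r) P) #u) (upsBefore-≤ (bd (suc r) l) (rotate^ (α r) P))

  potential-step : ∀ r P → r ≤ M → #right P ≡ k → #up P ≡ l →
    potential r P + 1 ≡ climb r P + potential (suc r) (rotate^ (α r) P) + isZero (violation r P)
  potential-step r P r≤M #r #u = begin
    potential r P + 1                        ≡⟨ cong (_+ 1) (excess⁻≡excess∸1 l _) ⟩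
    violation r P ∸ 1 + 1                    ≡⟨ ∸1+1 (violation r P) ⟩
    violation r P + isZero (violation r P)   ≡⟨ cong (_+ isZero (violation r P)) (violation-step r P r≤M #r #u) ⟨
    climb r P + potential (suc r) (rotate^ (α r) P) + isZero (violation r P) ∎
    where open ≡-Reasoning

  dominated≡isZero : ∀ (j : Fin M) P → #up P ≡ l → δ true (dominated (cshift j a) P) ≡ isZero (violation (M ∸ toℕ j) P)
  dominated≡isZero j P #u = δ-true≡isZero _ _ dominated⇒ ⇒dominated
    where
    open Domination (bdry (cshift j a)) _ (λ x y → refl)
    c : ℕ → ℕ
    c y = upsBefore (bd (M ∸ toℕ j) y) P
    bdry≡ : ∀ y → y ≤ l → bdry (cshift j a) y ≡ bd (M ∸ toℕ j) y
    bdry≡ y y≤l = bdry-cshift j y (≤-trans y≤l l≤M)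
    dominated⇒ : dominated (cshift j a) P ≡ true → violation (M ∸ toℕ j) P ≡ 0
    dominated⇒ d = bounded⇒excess≡0 l c (λ y 1≤y y≤l →
      subst (λ e → upsBefore e P < y) (bdry≡ y y≤l) (proj₂ (all-right-of⇒clear 0 0 P d) y 1≤y (subst (y ≤_) (sym #u) y≤l)))
    ⇒dominated : violation (M ∸ toℕ j) P ≡ 0 → dominated (cshift j a) P ≡ true
    ⇒dominated v = clear⇒all-right-of 0 0 P z≤n (λ y 1≤y y≤#u → let y≤l = subst (y ≤_) #u y≤#u in
      subst (λ e → upsBefore e P < y) (sym (bdry≡ y y≤l)) (excess≡0⇒bounded l c v y 1≤y y≤l))

  potentialSum climbSum goodCount : ℕ → ℕ
  potentialSum r = ∑[ x < N ] potential r (path# x)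
  climbSum     r = ∑[ x < N ] climb r (path# x)
  goodCount    r = ∑[ x < N ] isZero (violation r (path# x))

  -- Summing potential-step over all paths; rotation permutes the paths, so the rotated
  -- potentials add up to potentialSum (r + 1).
  potentialSum-step : ∀ r → r ≤ M → potentialSum r + N ≡ climbSum r + potentialSum (suc r) + goodCount r
  potentialSum-step r r≤M = begin
    potentialSum r + N                                        ≡⟨ cong (potentialSum r +_) (trans (∑-const N 1) (*-identityʳ N)) ⟨
    potentialSum r + ∑[ x < N ] 1                             ≡⟨ ∑-distrib-+ (λ x → potential r (path# x)) (λ _ → 1) ⟨
    ∑[ x < N ] (potential r (path# x) + 1)                    ≡⟨ sum-cong-≗ (λ x → potential-step r (path# x) r≤M (#right-path# x) (#up-path# x)) ⟩
    ∑[ x < N ] (climb r (path# x) + next (path# x) + isZero (violation r (path# x)))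
                                                              ≡⟨ ∑-distrib-+ (λ x → climb r (path# x) + next (path# x)) _ ⟩
    ∑[ x < N ] (climb r (path# x) + next (path# x)) + goodCount r
                                                              ≡⟨ cong (_+ goodCount r) (∑-distrib-+ (λ x → climb r (path# x)) _) ⟩
    climbSum r + ∑[ x < N ] next (path# x) + goodCount r      ≡⟨ cong (λ z → climbSum r + z + goodCount r) (∑-rotate^ (α r) (potential (suc r))) ⟩
    climbSum r + potentialSum (suc r) + goodCount r           ∎
    where
    open ≡-Reasoning
    next : List Step → ℕ
    next P = potential (suc r) (rotate^ (α r) P)

  potentialSum-periodic : potentialSum M ≡ potentialSum 0
  potentialSum-periodic = sum-cong-≗ (λ x → excess⁻-cong l _ _ (λ y _ _ → cong (λ d → upsBefore d (path# x)) (bd-periodic y)))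

  goodCount-periodic : goodCount M ≡ goodCount 0
  goodCount-periodic = sum-cong-≗ (λ x → cong isZero (excess-cong l _ _ (λ y _ _ → cong (λ d → upsBefore d (path# x)) (bd-periodic y))))

  -- Summing potentialSum-step over a period, the potentials telescope away:
  -- every (path, shift) pair either contributes to a climb or is good.
  cycle-identity : M * N ≡ sumTo M climbSum + sumTo M goodCount
  cycle-identity = +-cancelˡ-≡ Φ _ _ (begin
    Φ + M * N                                                ≡⟨ cong (Φ +_) (sumTo-const M N) ⟨
    Φ + sumTo M (λ _ → N)                                    ≡⟨ sumTo-+ M potentialSum (λ _ → N) ⟨
    sumTo M (λ r → potentialSum r + N)                       ≡⟨ sumTo-cong M _ _ (λ r r<M → potentialSum-step r (<⇒≤ r<M)) ⟩
    sumTo M (λ r → climbSum r + potentialSum (suc r) + goodCount r)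
                                                             ≡⟨ sumTo-+ M (λ r → climbSum r + potentialSum (suc r)) goodCount ⟩
    sumTo M (λ r → climbSum r + potentialSum (suc r)) + sumTo M goodCount
                                                             ≡⟨ cong (_+ sumTo M goodCount) (sumTo-+ M climbSum (λ r → potentialSum (suc r))) ⟩
    sumTo M climbSum + sumTo M (λ r → potentialSum (suc r)) + sumTo M goodCount
                                                             ≡⟨ cong (λ z → sumTo M climbSum + z + sumTo M goodCount)
                                                                     (sumTo-rotate M potentialSum potentialSum-periodic) ⟩
    sumTo M climbSum + Φ + sumTo M goodCount                 ≡⟨ cong (_+ sumTo M goodCount) (+-comm (sumTo M climbSum) Φ) ⟩
    Φ + sumTo M climbSum + sumTo M goodCount                 ≡⟨ +-assoc Φ _ _ ⟩
    Φ + (sumTo M climbSum + sumTo M goodCount)               ∎)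
    where
    open ≡-Reasoning
    Φ : ℕ
    Φ = sumTo M potentialSum

  -- U d is the total height at which the paths to (k , l) leave the strip x < d.
  -- By rotation invariance it is additive in d, hence linear for d ≤ k + 1.
  U : ℕ → ℕ
  U d = ∑[ x < N ] upsBefore d (path# x)

  U-+ : ∀ e d → e + d ≤ suc k → U (e + d) ≡ U e + U d
  U-+ e d e+d≤ = begin
    U (e + d)                                                           ≡⟨ sum-cong-≗ split ⟩
    ∑[ x < N ] (upsBefore e (path# x) + upsBefore d (rotate^ e (path# x))) ≡⟨ ∑-distrib-+ (λ x → upsBefore e (path# x)) _ ⟩
    U e + ∑[ x < N ] upsBefore d (rotate^ e (path# x))                  ≡⟨ cong (U e +_) (∑-rotate^ e (upsBefore d)) ⟩
    U e + U d                                                           ∎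
    where
    open ≡-Reasoning
    split : ∀ x → upsBefore (e + d) (path# x) ≡ upsBefore e (path# x) + upsBefore d (rotate^ e (path# x))
    split x = sym (trans
      (cong (upsBefore e (path# x) +_) (upsBefore-rotate^ e d (path# x) (subst (λ z → e + d ≤ suc z) (sym (#right-path# x)) e+d≤)))
      (m+[n∸m]≡n (upsBefore-mono (path# x) (m≤m+n e d))))

  U-linear : ∀ d → d ≤ suc k → U d ≡ d * U 1
  U-linear zero    _  = trans (∑-const N 0) (*-zeroʳ N)
  U-linear (suc d) d≤ = trans (U-+ 1 d d≤) (cong (U 1 +_) (U-linear d (≤-trans (n≤1+n d) d≤)))

  U-last : U (suc k) ≡ N * l
  U-last = trans (sum-cong-≗ (λ x → trans (upsBefore-all (suc k) (path# x) (s≤s (≤-reflexive (#right-path# x)))) (#up-path# x)))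
                 (∑-const N l)

  [k+1]*U1 : suc k * U 1 ≡ N * l
  [k+1]*U1 = trans (sym (U-linear (suc k) ≤-refl)) U-last

  U-flat : l ≡ 0 → ∀ d → U d ≡ 0
  U-flat l≡0 d = trans (sum-cong-≗ (λ x → n≤0⇒n≡0 (subst (upsBefore d (path# x) ≤_) (trans (#up-path# x) l≡0) (upsBefore-≤ d (path# x)))))
                       (trans (∑-const N 0) (*-zeroʳ N))

  -- The climbs are linear in the part sizes: climbSum r = U (α r) = α r * U 1, because α r = bd r 1 ≤ bd r l ≤ k + 1.
  climbSum≡ : ∀ r → r ≤ M → climbSum r ≡ α r * U 1
  climbSum≡ r r≤M with 1 ≤? l
  ... | yes 1≤l = U-linear (α r) (≤-trans (subst (_≤ bd r l) (bd-1 r) (bd-mono r 1≤l)) (bd≤ r r≤M))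
  ... | no  1≰l = trans (U-flat l≡0 (α r)) (sym (trans (cong (α r *_) (U-flat l≡0 1)) (*-zeroʳ (α r))))
    where
    l≡0 : l ≡ 0
    l≡0 = n<1⇒n≡0 (≰⇒> 1≰l)

  climbs≡ : sumTo M climbSum ≡ total a * U 1
  climbs≡ = trans (sumTo-cong M _ _ (λ r r<M → climbSum≡ r (<⇒≤ r<M)))
                  (trans (sumTo-*ʳ M α (U 1)) (cong (_* U 1) (sym total≡sumTo)))

module Pairs (m′ : ℕ) (a : Fin (suc m′) → ℕ) (k l : ℕ) (l≤M : l ≤ suc m′)
             (hyp : (j : Fin (suc m′)) → bdry (cshift j a) l ≤ suc k) where
  open Composition m′ a
  open Enumeration k l

  -- The cyclic shifts read a from the positions M − j ∈ {1, ..., M}, and position M is position 0,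
  -- so the hypothesis bounds the boundary read from every position.
  bd≤ : ∀ r → r ≤ M → bd r l ≤ suc k
  bd≤ zero    _        = subst (_≤ suc k) (bd-periodic l) (bd≤ M ≤-refl)
  bd≤ (suc r) (s≤s r≤) = subst (_≤ suc k) (trans (bdry-cshift j l l≤M) (cong (λ z → bd z l) M∸j≡)) (hyp j)
    where
    j : Fin M
    j = fromℕ< {m′ ∸ r} (s≤s (m∸n≤m m′ r))
    M∸j≡ : M ∸ toℕ j ≡ suc r
    M∸j≡ = trans (cong (M ∸_) (toℕ-fromℕ< (s≤s (m∸n≤m m′ r)))) (trans (+-∸-assoc 1 (m∸n≤m m′ r)) (cong suc (m∸[m∸n]≡n r≤)))

  open Counting m′ a k l l≤M bd≤

  pairs : Bool → ℕ
  pairs b = ∑[ j < M ] ∑[ x < N ] δ b (dominated (cshift j a) (path# x))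

  pairs-↔ : ∀ b → Σ (𝒜 a k l) (λ p → dominated (cshift (proj₂ p) a) (proj₁ (proj₁ p)) ≡ b) ↔ Fin (pairs b)
  pairs-↔ b = ↔-trans (↔-sym (Σ-↔ (↔-trans (×-comm _ _) (↔-sym (paths-↔ k l) ×-↔ ↔-refl)) ↔-refl))
                      (count-↔ M N (λ j x → dominated (cshift j a) (path# x)) b)

  pairs-total : pairs true + pairs false ≡ M * N
  pairs-total = begin
    pairs true + pairs false                     ≡⟨ ∑-distrib-+ (λ j → ∑[ x < N ] δ true (D j x)) (λ j → ∑[ x < N ] δ false (D j x)) ⟨
    ∑[ j < M ] (∑[ x < N ] δ true (D j x) + ∑[ x < N ] δ false (D j x))
                                                 ≡⟨ sum-cong-≗ (λ j → sym (∑-distrib-+ (λ x → δ true (D j x)) (λ x → δ false (D j x)))) ⟩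
    ∑[ j < M ] ∑[ x < N ] (δ true (D j x) + δ false (D j x))
                                                 ≡⟨ sum-cong-≗ (λ j → trans (sum-cong-≗ (λ x → δ-true+δ-false (D j x))) (∑-const N 1)) ⟩
    ∑[ j < M ] (N * 1)                           ≡⟨ ∑-const M (N * 1) ⟩
    M * (N * 1)                                  ≡⟨ cong (M *_) (*-identityʳ N) ⟩
    M * N                                        ∎
    where
    open ≡-Reasoning
    D : Fin M → Fin N → Bool
    D j x = dominated (cshift j a) (path# x)

  good-pairs : pairs true ≡ sumTo M goodCount
  good-pairs = begin
    pairs true                                   ≡⟨ sum-cong-≗ (λ j → sum-cong-≗ (λ x → dominated≡isZero j (path# x) (#up-path# x))) ⟩
    ∑[ j < M ] goodCount (M ∸ toℕ j)             ≡⟨ ∑-reverse M goodCount ⟩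
    sumTo M (λ r → goodCount (suc r))            ≡⟨ sumTo-rotate M goodCount goodCount-periodic ⟩
    sumTo M goodCount                            ∎
    where open ≡-Reasoning

  bad-pairs : pairs false ≡ total a * U 1
  bad-pairs = +-cancelˡ-≡ (pairs true) _ _ (begin
    pairs true + pairs false                     ≡⟨ pairs-total ⟩
    M * N                                        ≡⟨ cycle-identity ⟩
    sumTo M climbSum + sumTo M goodCount         ≡⟨ cong₂ _+_ climbs≡ (sym good-pairs) ⟩
    total a * U 1 + pairs true                   ≡⟨ +-comm (total a * U 1) (pairs true) ⟩
    pairs true + total a * U 1                   ∎)
    where open ≡-Reasoning

  U1≡ : U 1 ≡ choosePred (k + l) l
  U1≡ = choosePred-unique k l (U 1) [k+1]*U1

  𝒜-↔ : 𝒜 a k l ↔ Fin (M * ((k + l) C l))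
  𝒜-↔ = begin
    (PathTo k l × Fin M)        ↔⟨ paths-↔ k l ×-↔ ↔-refl ⟩
    (Fin N × Fin M)             ↔⟨ ×-comm _ _ ⟩
    (Fin M × Fin N)             ↔⟨ *↔× ⟨
    Fin (M * N)                 ≡⟨ cong (λ z → Fin (M * z)) (#paths≡C k l) ⟩
    Fin (M * ((k + l) C l))     ∎
    where open EquationalReasoning

  ℬ-↔ : ℬ a k l ↔ Fin (total a * choosePred (k + l) l)
  ℬ-↔ = subst (λ z → ℬ a k l ↔ Fin z) (trans bad-pairs (cong (total a *_) U1≡)) (pairs-↔ false)

  𝒢-↔ : 𝒢 a k l ↔ Fin (pairs true)
  𝒢-↔ = pairs-↔ true

  good+bad : pairs true + total a * choosePred (k + l) l ≡ M * ((k + l) C l)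
  good+bad = begin
    pairs true + total a * choosePred (k + l) l   ≡⟨ cong (λ z → pairs true + total a * z) U1≡ ⟨
    pairs true + total a * U 1                    ≡⟨ cong (pairs true +_) bad-pairs ⟨
    pairs true + pairs false                      ≡⟨ pairs-total ⟩
    M * N                                         ≡⟨ cong (M *_) (#paths≡C k l) ⟩
    M * ((k + l) C l)                             ∎
    where open ≡-Reasoning

  choosePred-absorption : suc k * choosePred (k + l) l ≡ l * ((k + l) C l)
  choosePred-absorption = begin
    suc k * choosePred (k + l) l  ≡⟨ cong (suc k *_) U1≡ ⟨
    suc k * U 1                   ≡⟨ [k+1]*U1 ⟩
    N * l                         ≡⟨ *-comm N l ⟩
    l * N                         ≡⟨ cong (l *_) (#paths≡C k l) ⟩
    l * ((k + l) C l)             ∎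
    where open ≡-Reasoning

-- Integer and rational arithmetic is only needed for the final formula.  It is imported here,
-- after the natural-number development, because the integer constructor +_ would make the
-- sections (x +_) used above ambiguous.
open import Data.Integer using (ℤ; +_; _-_) renaming (_*_ to _*ℤ_; _+_ to _+ℤ_)
open import Data.Integer.Properties using (pos-*; pos-+)
import Data.Integer.Tactic.RingSolver as ℤ-Solver
open import Data.Rational using (ℚ; _/_; toℚᵘ; fromℚᵘ) renaming (_*_ to _*ℚ_)
open import Data.Rational.Properties using (fromℚᵘ-toℚᵘ; toℚᵘ-homo-*; toℚᵘ-fromℚᵘ; fromℚᵘ-cong)
open import Data.Rational.Unnormalised using (ℚᵘ; mkℚᵘ; *≡*) renaming (_≃_ to _≃ᵘ_)
open import Data.Rational.Unnormalised.Properties using (≃-trans) renaming (*-cong to *ᵘ-cong)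

ℚ-formula : ∀ m n k l g N c → g + n * c ≡ m * N → suc k * c ≡ l * N →
            (+ g) / 1 ≡ ((+ m *ℤ + suc k - + n *ℤ + l) / suc k) *ℚ ((+ N) / 1)
ℚ-formula m n k l g N c g+nc≡mN Kc≡lN = sym (trans (sym (fromℚᵘ-toℚᵘ R)) (fromℚᵘ-cong R≃g))
  where
  K : ℕ
  K = suc k
  p : ℤ
  p = + m *ℤ + K - + n *ℤ + l
  u v : ℚᵘ
  u = mkℚᵘ p k
  v = mkℚᵘ (+ N) 0
  R : ℚ
  R = fromℚᵘ u *ℚ fromℚᵘ v
  in-ℕ : g * K + n * l * N ≡ m * K * N
  in-ℕ = begin
    g * K + n * l * N          ≡⟨ cong (λ z → g * K + z) (trans (*-assoc n l N) (cong (n *_) (sym Kc≡lN))) ⟩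
    g * K + n * (K * c)        ≡⟨ factor g n K c ⟩
    (g + n * c) * K            ≡⟨ cong (_* K) g+nc≡mN ⟩
    m * N * K                  ≡⟨ swap m N K ⟩
    m * K * N                  ∎
    where
    open ≡-Reasoning
    factor : ∀ g n K c → g * K + n * (K * c) ≡ (g + n * c) * K
    factor = solve-∀
    swap : ∀ m N K → m * N * K ≡ m * K * N
    swap = solve-∀
  in-ℤ : (p *ℤ + N) *ℤ + 1 ≡ + g *ℤ + (K * 1)
  in-ℤ = begin
    (p *ℤ + N) *ℤ + 1                                 ≡⟨ expand (+ m) (+ K) (+ n) (+ l) (+ N) ⟩
    (+ m *ℤ + K *ℤ + N) - (+ n *ℤ + l *ℤ + N)         ≡⟨ cong₂ _-_ (trans (cong (_*ℤ + N) (sym (pos-* m K))) (sym (pos-* (m * K) N)))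
                                                                   (trans (cong (_*ℤ + N) (sym (pos-* n l))) (sym (pos-* (n * l) N))) ⟩
    + (m * K * N) - + (n * l * N)                     ≡⟨ cong (λ z → + z - + (n * l * N)) in-ℕ ⟨
    + (g * K + n * l * N) - + (n * l * N)             ≡⟨ cong (_- + (n * l * N)) (pos-+ (g * K) (n * l * N)) ⟩
    (+ (g * K) +ℤ + (n * l * N)) - + (n * l * N)      ≡⟨ cancel (+ (g * K)) (+ (n * l * N)) ⟩
    + (g * K)                                         ≡⟨ pos-* g K ⟩
    + g *ℤ + K                                        ≡⟨ cong (λ z → + g *ℤ + z) (*-identityʳ K) ⟨
    + g *ℤ + (K * 1)                                  ∎
    where
    open ≡-Reasoning
    expand : ∀ m K n l N → ((m *ℤ K - n *ℤ l) *ℤ N) *ℤ + 1 ≡ m *ℤ K *ℤ N - n *ℤ l *ℤ N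
    expand = ℤ-Solver.solve-∀
    cancel : ∀ x y → (x +ℤ y) - y ≡ x
    cancel = ℤ-Solver.solve-∀
  R≃g : toℚᵘ R ≃ᵘ mkℚᵘ (+ g) 0
  R≃g = ≃-trans (toℚᵘ-homo-* (fromℚᵘ u) (fromℚᵘ v)) (≃-trans (*ᵘ-cong (toℚᵘ-fromℚᵘ u) (toℚᵘ-fromℚᵘ v)) (*≡* in-ℤ))

empty-↔ : {A : Set} → (A → Fin 0) → A ↔ Fin 0
empty-↔ f = mk↔ₛ′ f (λ ()) (λ ()) (λ x → case f x of λ ())

theorem1 : (m n : ℕ) (a : Fin m → ℕ) → total a ≡ n →
    (k l : ℕ) → k ≤ n → l ≤ m →
    ((j : Fin m) → bdry (cshift j a) l ≤ suc k) →
    (𝒜 a k l ↔ Fin (m * ((k + l) C l)))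
    × (ℬ a k l ↔ Fin (n * choosePred (k + l) l))
    × Σ ℕ (λ g → (𝒢 a k l ↔ Fin g)
        × (g + n * choosePred (k + l) l ≡ m * ((k + l) C l))
        × ((+ g) / 1 ≡ ((+ m *ℤ + suc k - + n *ℤ + l) / suc k) *ℚ ((+ ((k + l) C l)) / 1)))
theorem1 zero .0 a refl k .0 _ z≤n _ =
  empty-↔ proj₂ , empty-↔ (proj₂ ∘ proj₁) , 0 , empty-↔ (proj₂ ∘ proj₁) , refl ,
  ℚ-formula 0 0 k 0 0 ((k + 0) C 0) 0 refl (*-zeroʳ (suc k))
theorem1 (suc m′) .(total a) a refl k l _ l≤M hyp =
  𝒜-↔ , ℬ-↔ , pairs true , 𝒢-↔ , good+bad ,
  ℚ-formula (suc m′) (total a) k l (pairs true) ((k + l) C l) (choosePred (k + l) l) good+bad choosePred-absorption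
  where open Pairs m′ a k l l≤M hyp
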